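{- Let $b_0,b_1,b_2,\dots$ be indeterminates, $B(x)=\sum_{i\ge0}b_ix^i$, and let $g(x)$ be the unique formal power series with $g(x)=1+xg(x)B(x^2g(x))$. Let $m$ be a positive integer, let $r\ne s$ be nonnegative integers and $m_r,m_s$ nonnegative integers, and let $\left(m\,|\,b_r^{m_r}b_s^{m_s}\right)$ denote the coefficient of the monomial $b_r^{m_r}b_s^{m_s}$ in $[x^{m_r(2r+1)+m_s(2s+1)}]g^m(x)$. Then, with $k=m_r(r+1)+m_s(s+1)$, $$\left(m\,|\,b_r^{m_r}b_s^{m_s}\right)=\frac{m}{m+k-m_r-m_s}\binom{m+k-1}{m_r}\binom{m+k-1-m_r}{m_s}=\frac{m\,(m+k-1)!}{m_r!\,m_s!\,(m+k-m_r-m_s)!}.$$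
   Context: $[x^n]F(x)$ denotes the coefficient of $x^n$ in $F$. -}

module Defs where

open import Data.Nat using (ℕ; zero; suc; _+_; _*_; _∸_; _≤ᵇ_; _≡ᵇ_)
open import Data.Bool using (Bool; true; false; if_then_else_; _∧_)
open import Data.List using (List; []; _∷_; _++_; map; concatMap; length; filterᵇ; replicate; foldr)

-- Polynomials in the indeterminates b₀, b₁, b₂, … with coefficients in ℕ,
-- represented as formal sums (bags) of monomials; a monomial is a finite
-- multiset of indices, given as a list (the list [i, i, j] is b_i² b_j).
Mono : Set
Mono = List ℕ

Poly : Set
Poly = List Mono

zeroP : Poly
zeroP = []

oneP : Poly
oneP = [] ∷ []

var : ℕ → Poly
var i = (i ∷ []) ∷ []

_+P_ : Poly → Poly → Poly
p +P q = p ++ q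

_*P_ : Poly → Poly → Poly
p *P q = concatMap (λ a → map (a ++_) q) p

expo : ℕ → Mono → ℕ
expo i [] = 0
expo i (j ∷ js) = if i ≡ᵇ j then suc (expo i js) else expo i js

-- two monomials are the same monomial iff every index has the same exponent
-- (indices not occurring in either have exponent 0 in both)
sameMono : Mono → Mono → Bool
sameMono q M = foldr (λ i acc → (expo i q ≡ᵇ expo i M) ∧ acc) true (q ++ M)

coeff : Mono → Poly → ℕ
coeff M p = length (filterᵇ (λ q → sameMono q M) p)

_≈P_ : Poly → Poly → Set
p ≈P q = ∀ (M : Mono) → coeff M p ≡ coeff M q
  where open import Relation.Binary.PropositionalEquality using (_≡_)

Series : Set
Series = ℕ → Poly

sumTo : (ℕ → Poly) → ℕ → Poly
sumTo f zero = f 0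
sumTo f (suc n) = sumTo f n +P f (suc n)

oneS : Series
oneS zero = oneP
oneS (suc _) = zeroP

_*S_ : Series → Series → Series
(f *S h) n = sumTo (λ j → f j *P h (n ∸ j)) n

_^S_ : Series → ℕ → Series
g ^S zero = oneS
g ^S suc m = g *S (g ^S m)

shiftS : ℕ → Series → Series
shiftS k f n = if k ≤ᵇ n then f (n ∸ k) else zeroP

-- B(x² g(x)) = Σ_{i≥0} b_i x^{2i} g(x)^i ; the terms with i > n do not
-- contribute to [xⁿ], so [xⁿ] is the finite sum over i ≤ n.
BComp : Series → Series
BComp g n = sumTo (λ i → var i *P shiftS (2 * i) (g ^S i) n) n

rhsG : Series → Series
rhsG g n = oneS n +P shiftS 1 (g *S BComp g) n

IsG : Series → Set
IsG g = ∀ (n : ℕ) → g n ≈P rhsG g n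

mono2 : ℕ → ℕ → ℕ → ℕ → Mono
mono2 r mr s ms = replicate mr r ++ replicate ms s

{-# OPTIONS --safe #-}
module Submission where

-- Substituting b_r ↦ u, b_s ↦ v and b_t ↦ 0 for every other t is a semiring map from
-- polynomials in the b_i to ℕ[[u,v]], and the coefficient of b_r^a b_s^b is the coefficient
-- of u^a v^b of the image.  The image G of g satisfies G = 1 + x G (u x^{2r} G^r + v x^{2s} G^s),
-- so G^{m+1} = G^m + u x^{2r+1} G^{m+1+r} + v x^{2s+1} G^{m+1+s}.  Reading off the coefficient
-- c(m,a,b) of x^{a(2r+1)+b(2s+1)} u^a v^b gives the recurrence
--   c(m+1,a,b) = c(m,a,b) + c(m+1+r,a−1,b) + c(m+1+s,a,b−1),
-- from which c(m+1,a,b) · a! b! (m+1+ar+bs)! = (m+1) · (m+ar+bs+a+b)! follows by induction;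
-- the binomial form is the same identity after cancelling a! b! (m+ar+bs)!.

open import Level using (0ℓ)
open import Algebra.Bundles using (CommutativeSemiring)
open import Algebra.Structures using (IsCommutativeSemiring)
open import Data.Nat using (ℕ; zero; suc; _∸_; _≤_; _<_; _!; _≡ᵇ_; _≤ᵇ_; z≤n; s≤s)
import Data.Nat.Properties as ℕₚ
open import Data.Product using (_,_)
open import Function using (_∘_)
open import Data.List using (List; []; _∷_; _++_; map; replicate)
open import Relation.Binary.PropositionalEquality as ≡ using (_≡_; _≢_)
open import Relation.Binary.Structures using (IsEquivalence)
open import Relation.Nullary using (¬_; yes; no; contradiction)
open import Data.Bool using (T; true; false)
open import Data.Nat.Tactic.RingSolver using (solve-∀)
open import Data.Unit using (tt)

module PowerSeries (R : CommutativeSemiring 0ℓ 0ℓ) where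

  open CommutativeSemiring R hiding (isCommutativeSemiring)
  open import Relation.Binary.Reasoning.Setoid setoid
  open import Algebra.Properties.CommutativeSemigroup +-commutativeSemigroup using (interchange)

  Series : Set
  Series = ℕ → Carrier

  infix 4 _≈ₛ_
  _≈ₛ_ : Series → Series → Set
  f ≈ₛ g = ∀ n → f n ≈ g n

  infixl 6 _+ₛ_
  _+ₛ_ : Series → Series → Series
  (f +ₛ g) n = f n + g n

  0ₛ : Series
  0ₛ _ = 0#

  monomial : ℕ → Carrier → Series
  monomial zero    c zero    = c
  monomial zero    c (suc n) = 0#
  monomial (suc k) c zero    = 0#
  monomial (suc k) c (suc n) = monomial k c n

  1ₛ : Series
  1ₛ = monomial 0 1#

  tail : Series → Series
  tail f n = f (suc n)

  scale : Carrier → Series → Series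
  scale c f n = c * f n

  infixl 7 _*ₛ_
  _*ₛ_ : Series → Series → Series
  (f *ₛ g) zero    = f 0 * g 0
  (f *ₛ g) (suc n) = f 0 * g (suc n) + (tail f *ₛ g) n

  *ₛ-cong : ∀ {f f′ g g′} → f ≈ₛ f′ → g ≈ₛ g′ → f *ₛ g ≈ₛ f′ *ₛ g′
  *ₛ-cong f≈ g≈ zero    = *-cong (f≈ 0) (g≈ 0)
  *ₛ-cong f≈ g≈ (suc n) = +-cong (*-cong (f≈ 0) (g≈ (suc n))) (*ₛ-cong (λ k → f≈ (suc k)) g≈ n)

  *ₛ-zeroˡ : ∀ {f} g → f ≈ₛ 0ₛ → f *ₛ g ≈ₛ 0ₛ
  *ₛ-zeroˡ g f≈0 zero    = trans (*-congʳ (f≈0 0)) (zeroˡ _)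
  *ₛ-zeroˡ g f≈0 (suc n) =
    trans (+-cong (trans (*-congʳ (f≈0 0)) (zeroˡ _)) (*ₛ-zeroˡ g (λ k → f≈0 (suc k)) n)) (+-identityˡ _)

  *ₛ-identityˡ : ∀ g → 1ₛ *ₛ g ≈ₛ g
  *ₛ-identityˡ g zero    = *-identityˡ _
  *ₛ-identityˡ g (suc n) = trans (+-cong (*-identityˡ _) (*ₛ-zeroˡ g (λ _ → refl) n)) (+-identityʳ _)

  *ₛ-distribʳ : ∀ f h g → (f +ₛ h) *ₛ g ≈ₛ f *ₛ g +ₛ h *ₛ g
  *ₛ-distribʳ f h g zero    = distribʳ _ _ _
  *ₛ-distribʳ f h g (suc n) = begin
      (f 0 + h 0) * g (suc n) + (tail (f +ₛ h) *ₛ g) n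
    ≈⟨ +-cong (distribʳ _ _ _) (*ₛ-distribʳ (tail f) (tail h) g n) ⟩
      (f 0 * g (suc n) + h 0 * g (suc n)) + ((tail f *ₛ g) n + (tail h *ₛ g) n)
    ≈⟨ interchange _ _ _ _ ⟩
      (f 0 * g (suc n) + (tail f *ₛ g) n) + (h 0 * g (suc n) + (tail h *ₛ g) n)
    ∎

  *ₛ-scale : ∀ c f g → scale c f *ₛ g ≈ₛ scale c (f *ₛ g)
  *ₛ-scale c f g zero    = *-assoc _ _ _
  *ₛ-scale c f g (suc n) = trans (+-cong (*-assoc _ _ _) (*ₛ-scale c (tail f) g n)) (sym (distribˡ _ _ _))

  *ₛ-suc : ∀ f g n → (f *ₛ g) (suc n) ≈ (f *ₛ tail g) n + f (suc n) * g 0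
  *ₛ-suc f g zero    = refl
  *ₛ-suc f g (suc n) = begin
      f 0 * g (suc (suc n)) + (tail f *ₛ g) (suc n)
    ≈⟨ +-congˡ (*ₛ-suc (tail f) g n) ⟩
      f 0 * g (suc (suc n)) + ((tail f *ₛ tail g) n + f (suc (suc n)) * g 0)
    ≈⟨ sym (+-assoc _ _ _) ⟩
      (f 0 * g (suc (suc n)) + (tail f *ₛ tail g) n) + f (suc (suc n)) * g 0
    ∎

  *ₛ-comm : ∀ f g → f *ₛ g ≈ₛ g *ₛ f
  *ₛ-comm f g zero    = *-comm _ _
  *ₛ-comm f g (suc n) = begin
      f 0 * g (suc n) + (tail f *ₛ g) n
    ≈⟨ +-cong (*-comm _ _) (*ₛ-comm (tail f) g n) ⟩
      g (suc n) * f 0 + (g *ₛ tail f) n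
    ≈⟨ +-comm _ _ ⟩
      (g *ₛ tail f) n + g (suc n) * f 0
    ≈⟨ sym (*ₛ-suc g f n) ⟩
      (g *ₛ f) (suc n)
    ∎

  -- tail (f *ₛ g) is definitionally scale (f 0) (tail g) +ₛ tail f *ₛ g
  *ₛ-assoc : ∀ f g h → (f *ₛ g) *ₛ h ≈ₛ f *ₛ (g *ₛ h)
  *ₛ-assoc f g h zero    = *-assoc _ _ _
  *ₛ-assoc f g h (suc n) = begin
      (f 0 * g 0) * h (suc n) + (tail (f *ₛ g) *ₛ h) n
    ≈⟨ +-congˡ (*ₛ-distribʳ (scale (f 0) (tail g)) (tail f *ₛ g) h n) ⟩
      (f 0 * g 0) * h (suc n) + ((scale (f 0) (tail g) *ₛ h) n + ((tail f *ₛ g) *ₛ h) n)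
    ≈⟨ +-congˡ (+-cong (*ₛ-scale (f 0) (tail g) h n) (*ₛ-assoc (tail f) g h n)) ⟩
      (f 0 * g 0) * h (suc n) + (f 0 * (tail g *ₛ h) n + (tail f *ₛ (g *ₛ h)) n)
    ≈⟨ sym (+-assoc _ _ _) ⟩
      ((f 0 * g 0) * h (suc n) + f 0 * (tail g *ₛ h) n) + (tail f *ₛ (g *ₛ h)) n
    ≈⟨ +-congʳ (trans (+-congʳ (*-assoc _ _ _)) (sym (distribˡ _ _ _))) ⟩
      f 0 * (g 0 * h (suc n) + (tail g *ₛ h) n) + (tail f *ₛ (g *ₛ h)) n
    ∎

  ≈ₛ-isEquivalence : IsEquivalence _≈ₛ_
  ≈ₛ-isEquivalence = record
    { refl  = λ _ → refl
    ; sym   = λ f≈g n → sym (f≈g n)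
    ; trans = λ f≈g g≈h n → trans (f≈g n) (g≈h n)
    }

  isCommutativeSemiring : IsCommutativeSemiring _≈ₛ_ _+ₛ_ _*ₛ_ 0ₛ 1ₛ
  isCommutativeSemiring = record
    { isSemiring = record
      { isSemiringWithoutAnnihilatingZero = record
        { +-isCommutativeMonoid = record
          { isMonoid = record
            { isSemigroup = record
              { isMagma = record
                { isEquivalence = ≈ₛ-isEquivalence
                ; ∙-cong = λ f≈ g≈ n → +-cong (f≈ n) (g≈ n)
                }
              ; assoc = λ _ _ _ _ → +-assoc _ _ _
              }
            ; identity = (λ _ _ → +-identityˡ _) , (λ _ _ → +-identityʳ _)
            }
          ; comm = λ _ _ _ → +-comm _ _
          }
        ; *-cong     = *ₛ-cong
        ; *-assoc    = *ₛ-assoc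
        ; *-identity = *ₛ-identityˡ , λ g n → trans (*ₛ-comm g 1ₛ n) (*ₛ-identityˡ g n)
        ; distrib    = (λ f g h n → trans (*ₛ-comm f (g +ₛ h) n)
                                     (trans (*ₛ-distribʳ g h f n) (+-cong (*ₛ-comm g f n) (*ₛ-comm h f n))))
                     , (λ f g h → *ₛ-distribʳ g h f)
        }
      ; zero = (λ g → *ₛ-zeroˡ g (λ _ → refl))
             , (λ f n → trans (*ₛ-comm f 0ₛ n) (*ₛ-zeroˡ f (λ _ → refl) n))
      }
    ; *-comm = *ₛ-comm
    }

  commutativeSemiring : CommutativeSemiring 0ℓ 0ℓ
  commutativeSemiring = record { isCommutativeSemiring = isCommutativeSemiring }

  monomial-*ₛ-≤ : ∀ k c g n → k ≤ n → (monomial k c *ₛ g) n ≈ c * g (n ∸ k)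
  monomial-*ₛ-≤ zero    c g zero    _         = refl
  monomial-*ₛ-≤ zero    c g (suc n) _         = trans (+-congˡ (*ₛ-zeroˡ g (λ _ → refl) n)) (+-identityʳ _)
  monomial-*ₛ-≤ (suc k) c g (suc n) (s≤s k≤n) =
    trans (+-cong (zeroˡ _) (monomial-*ₛ-≤ k c g n k≤n)) (+-identityˡ _)

  monomial-*ₛ-< : ∀ k c g n → n < k → (monomial k c *ₛ g) n ≈ 0#
  monomial-*ₛ-< (suc k) c g zero    _         = zeroˡ _
  monomial-*ₛ-< (suc k) c g (suc n) (s≤s n<k) =
    trans (+-cong (zeroˡ _) (monomial-*ₛ-< k c g n n<k)) (+-identityˡ _)

  monomial-≢ : ∀ k c n → n ≢ k → monomial k c n ≡ 0#
  monomial-≢ zero    c zero    n≢k = contradiction ≡.refl n≢k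
  monomial-≢ zero    c (suc n) _   = ≡.refl
  monomial-≢ (suc k) c zero    _   = ≡.refl
  monomial-≢ (suc k) c (suc n) n≢k = monomial-≢ k c n (λ n≡k → n≢k (≡.cong suc n≡k))

  monomial-≡ : ∀ k c → monomial k c k ≡ c
  monomial-≡ zero    c = ≡.refl
  monomial-≡ (suc k) c = monomial-≡ k c

  monomial-*-≢ : ∀ k c x {n} → n ≢ k → monomial k c n * x ≈ 0#
  monomial-*-≢ k c x n≢k = trans (*-congʳ (reflexive (monomial-≢ k c _ n≢k))) (zeroˡ x)

  sum≤ : (ℕ → Carrier) → ℕ → Carrier
  sum≤ f zero    = f 0
  sum≤ f (suc n) = sum≤ f n + f (suc n)

  sum≤-cong : ∀ {f g} n → (∀ k → k ≤ n → f k ≈ g k) → sum≤ f n ≈ sum≤ g n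
  sum≤-cong zero    f≈g = f≈g 0 z≤n
  sum≤-cong (suc n) f≈g = +-cong (sum≤-cong n (λ k k≤n → f≈g k (ℕₚ.m≤n⇒m≤1+n k≤n))) (f≈g (suc n) ℕₚ.≤-refl)

  sum≤-suc : ∀ f n → sum≤ f (suc n) ≈ f 0 + sum≤ (λ k → f (suc k)) n
  sum≤-suc f zero    = refl
  sum≤-suc f (suc n) = trans (+-congʳ (sum≤-suc f n)) (+-assoc _ _ _)

  *ₛ-coefficient : ∀ f g n → (f *ₛ g) n ≈ sum≤ (λ j → f j * g (n ∸ j)) n
  *ₛ-coefficient f g zero    = refl
  *ₛ-coefficient f g (suc n) =
    trans (+-congˡ (*ₛ-coefficient (tail f) g n)) (sym (sum≤-suc (λ j → f j * g (suc n ∸ j)) n))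

  sum≤-+ : ∀ f g n → sum≤ (f +ₛ g) n ≈ sum≤ f n + sum≤ g n
  sum≤-+ f g zero    = refl
  sum≤-+ f g (suc n) = trans (+-congʳ (sum≤-+ f g n)) (interchange _ _ _ _)

  sum≤-zero : ∀ {f} n → (∀ k → k ≤ n → f k ≈ 0#) → sum≤ f n ≈ 0#
  sum≤-zero zero    f≈0 = f≈0 0 z≤n
  sum≤-zero (suc n) f≈0 =
    trans (+-cong (sum≤-zero n (λ k k≤n → f≈0 k (ℕₚ.m≤n⇒m≤1+n k≤n))) (f≈0 (suc n) ℕₚ.≤-refl)) (+-identityˡ _)

  sum≤-single : ∀ {f} k n → (∀ j → j ≢ k → f j ≈ 0#) → k ≤ n → sum≤ f n ≈ f k
  sum≤-single k zero    _   z≤n = refl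
  sum≤-single k (suc n) f≈0 k≤1+n with k ℕₚ.≤? n
  ... | yes k≤n = trans (+-cong (sum≤-single k n f≈0 k≤n) (f≈0 (suc n) (ℕₚ.<⇒≢ (s≤s k≤n) ∘ ≡.sym)))
                        (+-identityʳ _)
  ... | no k≰n with ℕₚ.≤-antisym k≤1+n (ℕₚ.≰⇒> k≰n)
  ...   | ≡.refl = trans (+-congʳ (sum≤-zero n (λ j j≤n → f≈0 j (ℕₚ.<⇒≢ (s≤s j≤n))))) (+-identityˡ _)

  sum≤-monomial : ∀ k c (f : ℕ → Carrier) n → (n < k → f k ≈ 0#) →
                  sum≤ (λ j → monomial k c j * f j) n ≈ c * f k
  sum≤-monomial k c f n fk≈0 with k ℕₚ.≤? n
  ... | yes k≤n = begin
      sum≤ (λ j → monomial k c j * f j) n  ≈⟨ sum≤-single k n (λ j → monomial-*-≢ k c (f j)) k≤n ⟩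
      monomial k c k * f k                 ≡⟨ ≡.cong (_* f k) (monomial-≡ k c) ⟩
      c * f k                              ∎
  ... | no  k≰n = begin
      sum≤ (λ j → monomial k c j * f j) n  ≈⟨ sum≤-zero n (λ j j≤n → monomial-*-≢ k c (f j) (j≢k j≤n)) ⟩
      0#                                   ≈⟨ zeroʳ c ⟨
      c * 0#                               ≈⟨ *-congˡ (fk≈0 n<k) ⟨
      c * f k                              ∎
    where
    n<k = ℕₚ.≰⇒> k≰n
    j≢k : ∀ {j} → j ≤ n → j ≢ k
    j≢k j≤n = ℕₚ.<⇒≢ (ℕₚ.≤-<-trans j≤n n<k)

open import Defs

module Evaluation (R : CommutativeSemiring 0ℓ 0ℓ) (ν : ℕ → CommutativeSemiring.Carrier R) where

  open CommutativeSemiring R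
  open PowerSeries R using (sum≤)

  evalMono : Mono → Carrier
  evalMono []      = 1#
  evalMono (i ∷ x) = ν i * evalMono x

  evalPoly : Poly → Carrier
  evalPoly []      = 0#
  evalPoly (x ∷ p) = evalMono x + evalPoly p

  evalMono-++ : ∀ x y → evalMono (x ++ y) ≈ evalMono x * evalMono y
  evalMono-++ []      y = sym (*-identityˡ _)
  evalMono-++ (i ∷ x) y = trans (*-congˡ (evalMono-++ x y)) (sym (*-assoc _ _ _))

  evalPoly-+P : ∀ p q → evalPoly (p +P q) ≈ evalPoly p + evalPoly q
  evalPoly-+P []      q = sym (+-identityˡ _)
  evalPoly-+P (x ∷ p) q = trans (+-congˡ (evalPoly-+P p q)) (sym (+-assoc _ _ _))

  evalPoly-map-++ : ∀ x q → evalPoly (map (x ++_) q) ≈ evalMono x * evalPoly q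
  evalPoly-map-++ x []      = sym (zeroʳ _)
  evalPoly-map-++ x (y ∷ q) =
    trans (+-cong (evalMono-++ x y) (evalPoly-map-++ x q)) (sym (distribˡ _ _ _))

  evalPoly-*P : ∀ p q → evalPoly (p *P q) ≈ evalPoly p * evalPoly q
  evalPoly-*P []      q = sym (zeroˡ _)
  evalPoly-*P (x ∷ p) q = begin
      evalPoly (map (x ++_) q +P (p *P q))
    ≈⟨ evalPoly-+P (map (x ++_) q) (p *P q) ⟩
      evalPoly (map (x ++_) q) + evalPoly (p *P q)
    ≈⟨ +-cong (evalPoly-map-++ x q) (evalPoly-*P p q) ⟩
      evalMono x * evalPoly q + evalPoly p * evalPoly q
    ≈⟨ sym (distribʳ _ _ _) ⟩
      (evalMono x + evalPoly p) * evalPoly q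
    ∎
    where open import Relation.Binary.Reasoning.Setoid setoid

  evalPoly-oneP : evalPoly oneP ≈ 1#
  evalPoly-oneP = +-identityʳ _

  evalPoly-var : ∀ i → evalPoly (var i) ≈ ν i
  evalPoly-var i = trans (+-identityʳ _) (*-identityʳ _)

  evalPoly-sumTo : ∀ F n → evalPoly (sumTo F n) ≈ sum≤ (λ j → evalPoly (F j)) n
  evalPoly-sumTo F zero    = refl
  evalPoly-sumTo F (suc n) = trans (evalPoly-+P (sumTo F n) (F (suc n))) (+-congʳ (evalPoly-sumTo F n))

open import Data.Nat using (_+_; _*_)
open ≡ using (refl; sym; trans; cong; cong₂; subst; subst₂)

module Monomials where

  open import Data.Bool using (Bool; _∧_)
  open import Data.Bool.Properties using (T-∧; T-≡)
  open import Data.Empty using (⊥-elim)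
  open import Data.Product using (proj₁; proj₂)
  open import Function.Bundles using (Equivalence)
  open import Data.List using (foldr)
  open import Data.List.Membership.Propositional using (_∈_; _∉_)
  open import Data.List.Membership.Propositional.Properties using (∈-++⁺ˡ; ∈-++⁺ʳ)
  open import Data.List.Membership.DecPropositional ℕₚ._≟_ using (_∈?_)
  open import Data.List.Relation.Unary.Any using (here; there)
  open Equivalence using (to; from)

  record Same (x y : Mono) : Set where
    constructor same-expo
    field expo-≡ : ∀ t → expo t x ≡ expo t y

  open Same public

  Same-sym : ∀ {x y} → Same x y → Same y x
  Same-sym x~y = same-expo λ t → sym (expo-≡ x~y t)

  Same-trans : ∀ {x y z} → Same x y → Same y z → Same x z
  Same-trans x~y y~z = same-expo λ t → trans (expo-≡ x~y t) (expo-≡ y~z t)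

  expo-∷-≡ : ∀ t x → expo t (t ∷ x) ≡ suc (expo t x)
  expo-∷-≡ t x with t ≡ᵇ t in eq
  ... | true  = refl
  ... | false = ⊥-elim (subst T eq (ℕₚ.≡⇒≡ᵇ t t refl))

  expo-∷-≢ : ∀ {t t′} x → t ≢ t′ → expo t (t′ ∷ x) ≡ expo t x
  expo-∷-≢ {t} {t′} x t≢t′ with t ≡ᵇ t′ in eq
  ... | true  = contradiction (ℕₚ.≡ᵇ⇒≡ t t′ (subst T (sym eq) tt)) t≢t′
  ... | false = refl

  expo-++ : ∀ t x y → expo t (x ++ y) ≡ expo t x + expo t y
  expo-++ t []       y = refl
  expo-++ t (t′ ∷ x) y with t ≡ᵇ t′
  ... | true  = cong suc (expo-++ t x y)
  ... | false = expo-++ t x y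

  expo-∉ : ∀ {t} x → t ∉ x → expo t x ≡ 0
  expo-∉ []       _   = refl
  expo-∉ (t′ ∷ x) t∉x = trans (expo-∷-≢ x (t∉x ∘ here)) (expo-∉ x (t∉x ∘ there))

  private
    agree : Mono → Mono → List ℕ → Bool
    agree x y = foldr (λ i acc → (expo i x ≡ᵇ expo i y) ∧ acc) true

    agree-sound : ∀ x y L → T (agree x y L) → ∀ {t} → t ∈ L → expo t x ≡ expo t y
    agree-sound x y (i ∷ L) h (here refl) = ℕₚ.≡ᵇ⇒≡ _ _ (proj₁ (to T-∧ h))
    agree-sound x y (i ∷ L) h (there t∈L)  = agree-sound x y L (proj₂ (to T-∧ h)) t∈L

    agree-complete : ∀ x y L → Same x y → T (agree x y L)
    agree-complete x y []      _    = tt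
    agree-complete x y (i ∷ L) same = from T-∧ (ℕₚ.≡⇒≡ᵇ _ _ (expo-≡ same i) , agree-complete x y L same)

  sameMono-sound : ∀ x y → sameMono x y ≡ true → Same x y
  sameMono-sound x y h = same-expo expo-agree
    where
    expo-agree : ∀ t → expo t x ≡ expo t y
    expo-agree t with t ∈? (x ++ y)
    ... | yes t∈ = agree-sound x y (x ++ y) (from T-≡ h) t∈
    ... | no  t∉ = trans (expo-∉ x (t∉ ∘ ∈-++⁺ˡ)) (sym (expo-∉ y (t∉ ∘ ∈-++⁺ʳ x)))

  sameMono-complete : ∀ x y → Same x y → sameMono x y ≡ true
  sameMono-complete x y = to T-≡ ∘ agree-complete x y (x ++ y)

  indicator : Bool → ℕ
  indicator true  = 1
  indicator false = 0

  coeff-∷ : ∀ M x p → coeff M (x ∷ p) ≡ indicator (sameMono x M) + coeff M p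
  coeff-∷ M x p with sameMono x M
  ... | true  = refl
  ... | false = refl

  indicator-sameMono-cong : ∀ x y x′ y′ → (Same x y → Same x′ y′) → (Same x′ y′ → Same x y) →
                            indicator (sameMono x y) ≡ indicator (sameMono x′ y′)
  indicator-sameMono-cong x y x′ y′ ⇒ ⇐ with sameMono x y in e | sameMono x′ y′ in e′
  ... | true  | true  = refl
  ... | false | false = refl
  ... | true  | false = contradiction (trans (sym (sameMono-complete x′ y′ (⇒ (sameMono-sound x y e)))) e′) λ ()
  ... | false | true  = contradiction (trans (sym (sameMono-complete x y (⇐ (sameMono-sound x′ y′ e′)))) e) λ ()

  indicator-sameMono-¬ : ∀ {x y} → ¬ Same x y → indicator (sameMono x y) ≡ 0
  indicator-sameMono-¬ {x} {y} ¬same with sameMono x y in e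
  ... | true  = contradiction (sameMono-sound x y e) ¬same
  ... | false = refl

  Same-∷⁻ : ∀ {t x y} → Same (t ∷ x) (t ∷ y) → Same x y
  Same-∷⁻ {t} {x} {y} same = same-expo expo-tail
    where
    expo-tail : ∀ t′ → expo t′ x ≡ expo t′ y
    expo-tail t′ with t′ ℕₚ.≟ t
    ... | yes refl = ℕₚ.suc-injective (trans (sym (expo-∷-≡ t x)) (trans (expo-≡ same t) (expo-∷-≡ t y)))
    ... | no  t′≢t   = trans (sym (expo-∷-≢ x t′≢t)) (trans (expo-≡ same t′) (expo-∷-≢ y t′≢t))

  Same-∷⁺ : ∀ {t x y} → Same x y → Same (t ∷ x) (t ∷ y)
  Same-∷⁺ {t} {x} {y} same = same-expo expo-cons
    where
    expo-cons : ∀ t′ → expo t′ (t ∷ x) ≡ expo t′ (t ∷ y)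
    expo-cons t′ with t′ ℕₚ.≟ t
    ... | yes refl = trans (expo-∷-≡ t x) (trans (cong suc (expo-≡ same t)) (sym (expo-∷-≡ t y)))
    ... | no  t′≢t   = trans (expo-∷-≢ x t′≢t) (trans (expo-≡ same t′) (sym (expo-∷-≢ y t′≢t)))

  Same-++-∷ : ∀ t x y → Same (x ++ t ∷ y) (t ∷ x ++ y)
  Same-++-∷ t x y = same-expo expo-moved
    where
    expo-moved : ∀ t′ → expo t′ (x ++ t ∷ y) ≡ expo t′ (t ∷ x ++ y)
    expo-moved t′ with t′ ℕₚ.≟ t
    ... | yes refl = begin
        expo t (x ++ t ∷ y)          ≡⟨ expo-++ t x (t ∷ y) ⟩
        expo t x + expo t (t ∷ y)  ≡⟨ cong (expo t x +_) (expo-∷-≡ t y) ⟩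
        expo t x + suc (expo t y)  ≡⟨ ℕₚ.+-suc (expo t x) (expo t y) ⟩
        suc (expo t x + expo t y)  ≡⟨ cong suc (expo-++ t x y) ⟨
        suc (expo t (x ++ y))        ≡⟨ expo-∷-≡ t (x ++ y) ⟨
        expo t (t ∷ x ++ y)          ∎
      where open ≡.≡-Reasoning
    ... | no  t′≢t = begin
        expo t′ (x ++ t ∷ y)           ≡⟨ expo-++ t′ x (t ∷ y) ⟩
        expo t′ x + expo t′ (t ∷ y)  ≡⟨ cong (expo t′ x +_) (expo-∷-≢ y t′≢t) ⟩
        expo t′ x + expo t′ y        ≡⟨ expo-++ t′ x y ⟨
        expo t′ (x ++ y)               ≡⟨ expo-∷-≢ (x ++ y) t′≢t ⟨
        expo t′ (t ∷ x ++ y)           ∎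
      where open ≡.≡-Reasoning

  ¬Same-[] : ∀ {t y n} → expo t y ≡ suc n → ¬ Same [] y
  ¬Same-[] {t} expo≡suc same = ℕₚ.0≢1+n (trans (expo-≡ same t) expo≡suc)

  ¬Same-∷ : ∀ {t x y} → expo t y ≡ 0 → ¬ Same (t ∷ x) y
  ¬Same-∷ {t} {x} expo≡0 same = ℕₚ.1+n≢0 (trans (sym (expo-∷-≡ t x)) (trans (expo-≡ same t) expo≡0))

  expo-replicate-≡ : ∀ t a → expo t (replicate a t) ≡ a
  expo-replicate-≡ t zero    = refl
  expo-replicate-≡ t (suc a) = trans (expo-∷-≡ t (replicate a t)) (cong suc (expo-replicate-≡ t a))

  expo-replicate-≢ : ∀ {t t′} a → t ≢ t′ → expo t (replicate a t′) ≡ 0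
  expo-replicate-≢ zero    _     = refl
  expo-replicate-≢ (suc a) t≢t′ = trans (expo-∷-≢ (replicate a _) t≢t′) (expo-replicate-≢ a t≢t′)

module ClosedForm (r s : ℕ) (c : ℕ → ℕ → ℕ → ℕ) where


  removeR : ℕ → ℕ → ℕ → ℕ
  removeR m zero    b = 0
  removeR m (suc a) b = c (suc m + r) a b

  removeS : ℕ → ℕ → ℕ → ℕ
  removeS m a zero    = 0
  removeS m a (suc b) = c (suc m + s) a b

  -- With the paper's m equal to suc m here and k = a(r+1) + b(s+1):
  -- suc (N m a b) = m + k − a − b and L m a b = m + k − 1.
  N : ℕ → ℕ → ℕ → ℕ
  N m a b = m + a * r + b * s

  L : ℕ → ℕ → ℕ → ℕ
  L m a b = N m a b + a + b

  denominator : ℕ → ℕ → ℕ → ℕ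
  denominator m a b = a ! * b ! * suc (N m a b) !

  N-sucʳ : ∀ m a b → N m (suc a) b ≡ N (m + r) a b
  N-sucʳ m a b = lemma m a b r s
    where lemma : ∀ m a b r s → m + (r + a * r) + b * s ≡ m + r + a * r + b * s
          lemma = solve-∀

  N-sucˢ : ∀ m a b → N m a (suc b) ≡ N (m + s) a b
  N-sucˢ m a b = lemma m a b r s
    where lemma : ∀ m a b r s → m + a * r + (s + b * s) ≡ m + s + a * r + b * s
          lemma = solve-∀

  L-sucʳ : ∀ m a b → L m (suc a) b ≡ suc (L (m + r) a b)
  L-sucʳ m a b = trans (cong (λ n → n + suc a + b) (N-sucʳ m a b)) (lemma (N (m + r) a b) a b)
    where lemma : ∀ n a b → n + suc a + b ≡ suc (n + a + b)
          lemma = solve-∀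

  L-sucˢ : ∀ m a b → L m a (suc b) ≡ suc (L (m + s) a b)
  L-sucˢ m a b = trans (cong (λ n → n + a + suc b) (N-sucˢ m a b)) (lemma (N (m + s) a b) a b)
    where lemma : ∀ n a b → n + a + suc b ≡ suc (n + a + b)
          lemma = solve-∀

  contributions-sum : ∀ m a b →
    m * suc (N m a b) + a * (suc m + r) + b * (suc m + s) ≡ suc m * L m a b
  contributions-sum m a b = lemma m a b r s
    where lemma : ∀ m a b r s → m * suc (m + a * r + b * s) + a * (suc m + r) + b * (suc m + s)
                                ≡ suc m * (m + a * r + b * s + a + b)
          lemma = solve-∀

  module _ (c-zero-zero : c 0 0 0 ≡ 1)
           (c-zero-sucʳ : ∀ a b → c 0 (suc a) b ≡ 0)
           (c-zero-sucˢ : ∀ b → c 0 0 (suc b) ≡ 0)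
           (c-suc : ∀ m a b → c (suc m) a b ≡ c m a b + removeR m a b + removeS m a b) where

    open ≡.≡-Reasoning

    closed-form-step : ∀ m a b ℓ → suc ℓ ≡ L m a b →
      c m a b * denominator m a b ≡ m * suc (N m a b) * ℓ ! →
      removeR m a b * denominator m a b ≡ a * (suc m + r) * ℓ ! →
      removeS m a b * denominator m a b ≡ b * (suc m + s) * ℓ ! →
      c (suc m) a b * denominator m a b ≡ suc m * L m a b !
    closed-form-step m a b ℓ sucℓ≡L stay viaR viaS = begin
        c (suc m) a b * D
      ≡⟨ cong (_* D) (c-suc m a b) ⟩
        (c m a b + removeR m a b + removeS m a b) * D
      ≡⟨ *-distribʳ-+₃ (c m a b) (removeR m a b) (removeS m a b) D ⟩
        c m a b * D + removeR m a b * D + removeS m a b * D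
      ≡⟨ cong₂ _+_ (cong₂ _+_ stay viaR) viaS ⟩
        m * suc (N m a b) * ℓ ! + a * (suc m + r) * ℓ ! + b * (suc m + s) * ℓ !
      ≡⟨ *-distribʳ-+₃ (m * suc (N m a b)) (a * (suc m + r)) (b * (suc m + s)) (ℓ !) ⟨
        (m * suc (N m a b) + a * (suc m + r) + b * (suc m + s)) * ℓ !
      ≡⟨ cong (_* ℓ !) (trans (contributions-sum m a b) (cong (suc m *_) (sym sucℓ≡L))) ⟩
        suc m * suc ℓ * ℓ !
      ≡⟨ ℕₚ.*-assoc (suc m) (suc ℓ) (ℓ !) ⟩
        suc m * suc ℓ !
      ≡⟨ cong (λ n → suc m * n !) sucℓ≡L ⟩
        suc m * L m a b !
      ∎
      where
      D = denominator m a b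
      *-distribʳ-+₃ : ∀ x y z w → (x + y + z) * w ≡ x * w + y * w + z * w
      *-distribʳ-+₃ x y z w = trans (ℕₚ.*-distribʳ-+ w (x + y) z) (cong (_+ z * w) (ℕₚ.*-distribʳ-+ w x y))

    -- mutual induction, lexicographic in (a, b, m)
    closed-form : ∀ a b m → c (suc m) a b * denominator m a b ≡ suc m * L m a b !
    stay-term : ∀ a b m ℓ → suc ℓ ≡ L m a b → c m a b * denominator m a b ≡ m * suc (N m a b) * ℓ !
    r-term : ∀ a b m ℓ → suc ℓ ≡ L m a b → removeR m a b * denominator m a b ≡ a * (suc m + r) * ℓ !
    s-term : ∀ a b m ℓ → suc ℓ ≡ L m a b → removeS m a b * denominator m a b ≡ b * (suc m + s) * ℓ !

    closed-form-via : ∀ a b m ℓ → suc ℓ ≡ L m a b → c (suc m) a b * denominator m a b ≡ suc m * L m a b !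
    closed-form-via a b m ℓ sucℓ≡L =
      closed-form-step m a b ℓ sucℓ≡L (stay-term a b m ℓ sucℓ≡L) (r-term a b m ℓ sucℓ≡L) (s-term a b m ℓ sucℓ≡L)

    closed-form zero    zero    zero    =
      trans (ℕₚ.*-identityʳ (c 1 0 0)) (trans (c-suc 0 0 0) (cong (λ n → n + 0 + 0) c-zero-zero))
    closed-form zero    zero    (suc m) = closed-form-via 0 0 (suc m) (L m 0 0) refl
    closed-form zero    (suc b) m       = closed-form-via 0 (suc b) m (L (m + s) 0 b) (sym (L-sucˢ m 0 b))
    closed-form (suc a) b       m       = closed-form-via (suc a) b m (L (m + r) a b) (sym (L-sucʳ m a b))

    stay-term zero    zero    zero    ℓ ()
    stay-term (suc a) b       zero    ℓ _ = cong (_* denominator 0 (suc a) b) (c-zero-sucʳ a b)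
    stay-term zero    (suc b) zero    ℓ _ = cong (_* denominator 0 0 (suc b)) (c-zero-sucˢ b)
    stay-term a       b       (suc m) ℓ sucℓ≡L = begin
        c (suc m) a b * (a ! * b ! * (suc n * suc (N m a b) !))
      ≡⟨ pull (c (suc m) a b) (a !) (b !) (suc n) (suc (N m a b) !) ⟩
        suc n * (c (suc m) a b * denominator m a b)
      ≡⟨ cong (suc n *_) (closed-form a b m) ⟩
        suc n * (suc m * L m a b !)
      ≡⟨ swap (suc n) (suc m) (L m a b !) ⟩
        suc m * suc n * L m a b !
      ≡⟨ cong (λ k → suc m * suc n * k !) (ℕₚ.suc-injective sucℓ≡L) ⟨
        suc m * suc n * ℓ !
      ∎
      where
      n = N (suc m) a b
      pull : ∀ x A B k Y → x * (A * B * (k * Y)) ≡ k * (x * (A * B * Y))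
      pull = solve-∀
      swap : ∀ k j Y → k * (j * Y) ≡ j * k * Y
      swap = solve-∀

    r-term zero    b m ℓ _      = refl
    r-term (suc a) b m ℓ sucℓ≡L = begin
        c (suc (m + r)) a b * (suc a * a ! * b ! * suc (N m (suc a) b) !)
      ≡⟨ pull (c (suc (m + r)) a b) (a !) (b !) (suc a) (suc (N m (suc a) b) !) ⟩
        suc a * (c (suc (m + r)) a b * (a ! * b ! * suc (N m (suc a) b) !))
      ≡⟨ cong (λ n → suc a * (c (suc (m + r)) a b * (a ! * b ! * suc n !))) (N-sucʳ m a b) ⟩
        suc a * (c (suc (m + r)) a b * denominator (m + r) a b)
      ≡⟨ cong (suc a *_) (closed-form a b (m + r)) ⟩
        suc a * (suc (m + r) * L (m + r) a b !)
      ≡⟨ ℕₚ.*-assoc (suc a) (suc (m + r)) (L (m + r) a b !) ⟨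
        suc a * suc (m + r) * L (m + r) a b !
      ≡⟨ cong (λ k → suc a * suc (m + r) * k !) (ℕₚ.suc-injective (trans sucℓ≡L (L-sucʳ m a b))) ⟨
        suc a * (suc m + r) * ℓ !
      ∎
      where
      pull : ∀ x A B k Y → x * (k * A * B * Y) ≡ k * (x * (A * B * Y))
      pull = solve-∀

    s-term a zero    m ℓ _      = refl
    s-term a (suc b) m ℓ sucℓ≡L = begin
        c (suc (m + s)) a b * (a ! * (suc b * b !) * suc (N m a (suc b)) !)
      ≡⟨ pull (c (suc (m + s)) a b) (a !) (b !) (suc b) (suc (N m a (suc b)) !) ⟩
        suc b * (c (suc (m + s)) a b * (a ! * b ! * suc (N m a (suc b)) !))
      ≡⟨ cong (λ n → suc b * (c (suc (m + s)) a b * (a ! * b ! * suc n !))) (N-sucˢ m a b) ⟩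
        suc b * (c (suc (m + s)) a b * denominator (m + s) a b)
      ≡⟨ cong (suc b *_) (closed-form a b (m + s)) ⟩
        suc b * (suc (m + s) * L (m + s) a b !)
      ≡⟨ ℕₚ.*-assoc (suc b) (suc (m + s)) (L (m + s) a b !) ⟨
        suc b * suc (m + s) * L (m + s) a b !
      ≡⟨ cong (λ k → suc b * suc (m + s) * k !) (ℕₚ.suc-injective (trans sucℓ≡L (L-sucˢ m a b))) ⟨
        suc b * (suc m + s) * ℓ !
      ∎
      where
      pull : ∀ x A B k Y → x * (A * (k * B) * Y) ≡ k * (x * (A * B * Y))
      pull = solve-∀

module TwoVariables {r s : ℕ} (r≢s : r ≢ s) where

  open Monomials

  module ℕ⟦v⟧      = PowerSeries ℕₚ.+-*-commutativeSemiring
  module ℕ⟦u,v⟧    = PowerSeries ℕ⟦v⟧.commutativeSemiring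
  module ℕ⟦u,v⟧⟦x⟧ = PowerSeries ℕ⟦u,v⟧.commutativeSemiring

  open ℕ⟦u,v⟧ using (_*ₛ_; _+ₛ_)

  u v : ℕ⟦u,v⟧.Series
  u = ℕ⟦u,v⟧.monomial 1 ℕ⟦v⟧.1ₛ
  v = ℕ⟦u,v⟧.monomial 0 (ℕ⟦v⟧.monomial 1 1)

  ν : ℕ → ℕ⟦u,v⟧.Series
  ν t = ℕ⟦u,v⟧⟦x⟧.monomial r u t +ₛ ℕ⟦u,v⟧⟦x⟧.monomial s v t

  open Evaluation ℕ⟦u,v⟧.commutativeSemiring ν

  mono : ℕ → ℕ → Mono
  mono a b = mono2 r a s b

  u-*ₛ-suc : ∀ F a b → (u *ₛ F) (suc a) b ≡ F a b
  u-*ₛ-suc F a b = trans (ℕ⟦u,v⟧.monomial-*ₛ-≤ 1 ℕ⟦v⟧.1ₛ F (suc a) (s≤s z≤n) b) (ℕ⟦v⟧.*ₛ-identityˡ (F a) b)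

  u-*ₛ-zero : ∀ F b → (u *ₛ F) 0 b ≡ 0
  u-*ₛ-zero F = ℕ⟦u,v⟧.monomial-*ₛ-< 1 ℕ⟦v⟧.1ₛ F 0 (s≤s z≤n)

  v-*ₛ-suc : ∀ F a b → (v *ₛ F) a (suc b) ≡ F a b
  v-*ₛ-suc F a b = trans (ℕ⟦u,v⟧.monomial-*ₛ-≤ 0 _ F a z≤n (suc b))
                           (trans (ℕ⟦v⟧.monomial-*ₛ-≤ 1 1 (F a) (suc b) (s≤s z≤n)) (ℕₚ.+-identityʳ _))

  v-*ₛ-zero : ∀ F a → (v *ₛ F) a 0 ≡ 0
  v-*ₛ-zero F a = trans (ℕ⟦u,v⟧.monomial-*ₛ-≤ 0 _ F a z≤n 0) (ℕ⟦v⟧.monomial-*ₛ-< 1 1 (F a) 0 (s≤s z≤n))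

  ν-r : ν r ℕ⟦u,v⟧.≈ₛ u
  ν-r a b rewrite ℕ⟦u,v⟧⟦x⟧.monomial-≡ r u | ℕ⟦u,v⟧⟦x⟧.monomial-≢ s v r r≢s = ℕₚ.+-identityʳ _

  ν-s : ν s ℕ⟦u,v⟧.≈ₛ v
  ν-s a b rewrite ℕ⟦u,v⟧⟦x⟧.monomial-≢ r u s (r≢s ∘ sym) | ℕ⟦u,v⟧⟦x⟧.monomial-≡ s v = refl

  ν-other : ∀ {t} → t ≢ r → t ≢ s → ν t ℕ⟦u,v⟧.≈ₛ ℕ⟦u,v⟧.0ₛ
  ν-other {t} t≢r t≢s a b rewrite ℕ⟦u,v⟧⟦x⟧.monomial-≢ r u t t≢r | ℕ⟦u,v⟧⟦x⟧.monomial-≢ s v t t≢s = refl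

  expo-mono-r : ∀ a b → expo r (mono a b) ≡ a
  expo-mono-r a b = begin
    expo r (mono a b)                                ≡⟨ expo-++ r (replicate a r) _ ⟩
    expo r (replicate a r) + expo r (replicate b s)  ≡⟨ cong₂ _+_ (expo-replicate-≡ r a) (expo-replicate-≢ b r≢s) ⟩
    a + 0                                            ≡⟨ ℕₚ.+-identityʳ a ⟩
    a                                                ∎
    where open ≡.≡-Reasoning

  expo-mono-s : ∀ a b → expo s (mono a b) ≡ b
  expo-mono-s a b = trans (expo-++ s (replicate a r) _)
                          (cong₂ _+_ (expo-replicate-≢ a (r≢s ∘ sym)) (expo-replicate-≡ s b))

  expo-mono-other : ∀ {t} a b → t ≢ r → t ≢ s → expo t (mono a b) ≡ 0
  expo-mono-other a b t≢r t≢s = trans (expo-++ _ (replicate a r) _)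
                                      (cong₂ _+_ (expo-replicate-≢ a t≢r) (expo-replicate-≢ b t≢s))

  indicator-[] : ∀ a b → indicator (sameMono [] (mono a b)) ≡ ℕ⟦u,v⟧.1ₛ a b
  indicator-[] zero    zero    = refl
  indicator-[] (suc a) b       = indicator-sameMono-¬ {[]} {mono (suc a) b} (¬Same-[] (expo-mono-r (suc a) b))
  indicator-[] zero    (suc b) = indicator-sameMono-¬ {[]} {mono 0 (suc b)} (¬Same-[] (expo-mono-s 0 (suc b)))

  indicator-∷-sucʳ : ∀ x a b → indicator (sameMono (r ∷ x) (mono (suc a) b)) ≡ indicator (sameMono x (mono a b))
  indicator-∷-sucʳ x a b = indicator-sameMono-cong (r ∷ x) (mono (suc a) b) x (mono a b) Same-∷⁻ Same-∷⁺

  indicator-∷-sucˢ : ∀ x a b → indicator (sameMono (s ∷ x) (mono a (suc b))) ≡ indicator (sameMono x (mono a b))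
  indicator-∷-sucˢ x a b = indicator-sameMono-cong (s ∷ x) (mono a (suc b)) x (mono a b)
    (λ same → Same-∷⁻ (Same-trans same s-to-front))
    (λ same → Same-trans (Same-∷⁺ same) (Same-sym s-to-front))
    where
    s-to-front : Same (mono a (suc b)) (s ∷ mono a b)
    s-to-front = Same-++-∷ s (replicate a r) (replicate b s)

  indicator-∷-absent : ∀ {t} x a b → expo t (mono a b) ≡ 0 → indicator (sameMono (t ∷ x) (mono a b)) ≡ 0
  indicator-∷-absent {t} x a b expo≡0 = indicator-sameMono-¬ {t ∷ x} {mono a b} (¬Same-∷ expo≡0)

  evalMono-indicator : ∀ x a b → evalMono x a b ≡ indicator (sameMono x (mono a b))
  evalMono-indicator []      a b = sym (indicator-[] a b)
  evalMono-indicator (t ∷ x) a b with t ℕₚ.≟ r | t ℕₚ.≟ s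
  ... | yes refl | _ = trans (ℕ⟦u,v⟧.*ₛ-cong ν-r (λ _ _ → refl) a b) (u-step a)
    where
    u-step : ∀ a → (u *ₛ evalMono x) a b ≡ indicator (sameMono (r ∷ x) (mono a b))
    u-step zero    = trans (u-*ₛ-zero (evalMono x) b) (sym (indicator-∷-absent x 0 b (expo-mono-r 0 b)))
    u-step (suc a) = trans (u-*ₛ-suc (evalMono x) a b)
                           (trans (evalMono-indicator x a b) (sym (indicator-∷-sucʳ x a b)))
  ... | no _ | yes refl = trans (ℕ⟦u,v⟧.*ₛ-cong ν-s (λ _ _ → refl) a b) (v-step b)
    where
    v-step : ∀ b → (v *ₛ evalMono x) a b ≡ indicator (sameMono (s ∷ x) (mono a b))
    v-step zero    = trans (v-*ₛ-zero (evalMono x) a) (sym (indicator-∷-absent x a 0 (expo-mono-s a 0)))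
    v-step (suc b) = trans (v-*ₛ-suc (evalMono x) a b)
                           (trans (evalMono-indicator x a b) (sym (indicator-∷-sucˢ x a b)))
  ... | no t≢r | no t≢s = trans (ℕ⟦u,v⟧.*ₛ-zeroˡ (evalMono x) (ν-other t≢r t≢s) a b)
                                (sym (indicator-∷-absent x a b (expo-mono-other a b t≢r t≢s)))

  coeff-mono : ∀ p a b → coeff (mono a b) p ≡ evalPoly p a b
  coeff-mono []      a b = refl
  coeff-mono (x ∷ p) a b = trans (coeff-∷ (mono a b) x p)
                                   (cong₂ _+_ (sym (evalMono-indicator x a b)) (coeff-mono p a b))

module EvaluatedSeries {r s : ℕ} (r≢s : r ≢ s) where

  open TwoVariables r≢s
  open Evaluation ℕ⟦u,v⟧.commutativeSemiring ν
  private
    module UV = CommutativeSemiring ℕ⟦u,v⟧.commutativeSemiring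
    module X  = CommutativeSemiring ℕ⟦u,v⟧⟦x⟧.commutativeSemiring
  open import Algebra.Definitions.RawSemiring X.rawSemiring using (_^_)
  open ℕ⟦u,v⟧⟦x⟧ using (monomial; monomial-*ₛ-≤; monomial-*ₛ-<; *ₛ-coefficient;
                        sum≤; sum≤-cong; sum≤-+; sum≤-monomial)

  evalSeries : Series → ℕ⟦u,v⟧⟦x⟧.Series
  evalSeries f n = evalPoly (f n)

  const : ℕ⟦u,v⟧.Series → ℕ⟦u,v⟧⟦x⟧.Series
  const = monomial 0

  x^_ : ℕ → ℕ⟦u,v⟧⟦x⟧.Series
  x^ k = monomial k UV.1#

  B : ℕ⟦u,v⟧⟦x⟧.Series → ℕ⟦u,v⟧⟦x⟧.Series
  B G = const u X.* (x^ (2 * r) X.* G ^ r) X.+ const v X.* (x^ (2 * s) X.* G ^ s)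

  evalSeries-*S : ∀ f h → evalSeries (f *S h) X.≈ evalSeries f X.* evalSeries h
  evalSeries-*S f h n = UV.trans (evalPoly-sumTo (λ j → f j *P h (n ∸ j)) n)
    (UV.trans (sum≤-cong n (λ j _ → evalPoly-*P (f j) (h (n ∸ j))))
              (UV.sym (*ₛ-coefficient (evalSeries f) (evalSeries h) n)))

  evalSeries-oneS : evalSeries oneS X.≈ X.1#
  evalSeries-oneS zero    = evalPoly-oneP
  evalSeries-oneS (suc n) = UV.refl

  evalSeries-^S : ∀ f m → evalSeries (f ^S m) X.≈ evalSeries f ^ m
  evalSeries-^S f zero    = evalSeries-oneS
  evalSeries-^S f (suc m) = X.trans (evalSeries-*S f (f ^S m)) (X.*-congˡ (evalSeries-^S f m))

  evalSeries-shiftS : ∀ k f → evalSeries (shiftS k f) X.≈ x^ k X.* evalSeries f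
  evalSeries-shiftS k f n with k ≤ᵇ n in eq
  ... | true  = UV.sym (UV.trans (monomial-*ₛ-≤ k UV.1# (evalSeries f) n k≤n) (UV.*-identityˡ _))
    where
    k≤n : k ≤ n
    k≤n = ℕₚ.≤ᵇ⇒≤ k n (subst T (sym eq) tt)
  ... | false = UV.sym (monomial-*ₛ-< k UV.1# (evalSeries f) n (ℕₚ.≰⇒> k≰n))
    where
    k≰n : ¬ k ≤ n
    k≰n k≤n = subst T eq (ℕₚ.≤⇒≤ᵇ k≤n)

  evalSeries-BComp : ∀ g → evalSeries (BComp g) X.≈ B (evalSeries g)
  evalSeries-BComp g n = begin
      evalPoly (sumTo (λ i → var i *P shiftS (2 * i) (g ^S i) n) n)
    ≈⟨ evalPoly-sumTo (λ i → var i *P shiftS (2 * i) (g ^S i) n) n ⟩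
      sum≤ (λ i → evalPoly (var i *P shiftS (2 * i) (g ^S i) n)) n
    ≈⟨ sum≤-cong n (λ i _ → evalPoly-term i) ⟩
      sum≤ (λ i → ν i UV.* P i) n
    ≈⟨ sum≤-cong n (λ i _ → UV.distribʳ (P i) _ _) ⟩
      sum≤ (λ i → monomial r u i UV.* P i UV.+ monomial s v i UV.* P i) n
    ≈⟨ sum≤-+ (λ i → monomial r u i UV.* P i) (λ i → monomial s v i UV.* P i) n ⟩
      sum≤ (λ i → monomial r u i UV.* P i) n UV.+ sum≤ (λ i → monomial s v i UV.* P i) n
    ≈⟨ UV.+-cong (sum≤-monomial r u P n (P-vanishes r)) (sum≤-monomial s v P n (P-vanishes s)) ⟩
      u UV.* P r UV.+ v UV.* P s
    ≈⟨ UV.sym (UV.+-cong (monomial-*ₛ-≤ 0 u _ n z≤n) (monomial-*ₛ-≤ 0 v _ n z≤n)) ⟩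
      B G n
    ∎
    where
    open import Relation.Binary.Reasoning.Setoid UV.setoid
    G = evalSeries g
    P : ℕ → ℕ⟦u,v⟧.Series
    P i = (x^ (2 * i) X.* G ^ i) n
    evalPoly-term : ∀ i → evalPoly (var i *P shiftS (2 * i) (g ^S i) n) UV.≈ ν i UV.* P i
    evalPoly-term i = UV.trans (evalPoly-*P (var i) (shiftS (2 * i) (g ^S i) n))
      (UV.*-cong (evalPoly-var i) (X.trans (evalSeries-shiftS (2 * i) (g ^S i)) (X.*-congˡ (evalSeries-^S g i)) n))
    P-vanishes : ∀ i → n < i → P i UV.≈ UV.0#
    P-vanishes i n<i = monomial-*ₛ-< (2 * i) UV.1# (G ^ i) n (ℕₚ.<-≤-trans n<i (ℕₚ.m≤n*m i 2))

  evalSeries-rhsG : ∀ g → evalSeries (rhsG g) X.≈ X.1# X.+ x^ 1 X.* (evalSeries g X.* B (evalSeries g))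
  evalSeries-rhsG g n = UV.trans (evalPoly-+P (oneS n) (shiftS 1 (g *S BComp g) n))
    (UV.+-cong (evalSeries-oneS n)
               (X.trans (evalSeries-shiftS 1 (g *S BComp g))
                        (X.*-congˡ (X.trans (evalSeries-*S g (BComp g)) (X.*-congˡ (evalSeries-BComp g)))) n))

  evalSeries-IsG : ∀ g → IsG g → evalSeries g X.≈ X.1# X.+ x^ 1 X.* (evalSeries g X.* B (evalSeries g))
  evalSeries-IsG g isG n a b = begin
    evalSeries g n a b                ≡⟨ coeff-mono (g n) a b ⟨
    coeff (mono a b) (g n)            ≡⟨ isG n (mono a b) ⟩
    coeff (mono a b) (rhsG g n)       ≡⟨ coeff-mono (rhsG g n) a b ⟩
    evalSeries (rhsG g) n a b         ≡⟨ evalSeries-rhsG g n a b ⟩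
    (X.1# X.+ x^ 1 X.* (evalSeries g X.* B (evalSeries g))) n a b  ∎
    where open ≡.≡-Reasoning

  coeff-mono-^S : ∀ g m n a b → coeff (mono a b) ((g ^S m) n) ≡ (evalSeries g ^ m) n a b
  coeff-mono-^S g m n a b = trans (coeff-mono ((g ^S m) n) a b) (evalSeries-^S g m n a b)

  ^-suc-expansion : ∀ G → G X.≈ X.1# X.+ x^ 1 X.* (G X.* B G) → ∀ m →
    G ^ suc m X.≈ G ^ m X.+ const u X.* (x^ 1 X.* (x^ (2 * r) X.* G ^ (suc m + r)))
                        X.+ const v X.* (x^ 1 X.* (x^ (2 * s) X.* G ^ (suc m + s)))
  ^-suc-expansion G G≈ m = begin
      G X.* G ^ m
    ≈⟨ X.*-congʳ G≈ ⟩
      (X.1# X.+ x^ 1 X.* (G X.* B G)) X.* G ^ m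
    ≈⟨ solve 9 (λ g gᵐ x u′ xʳ gʳ v′ xˢ gˢ →
                  (con 1 :+ x :* (g :* (u′ :* (xʳ :* gʳ) :+ v′ :* (xˢ :* gˢ)))) :* gᵐ
               := gᵐ :+ u′ :* (x :* (xʳ :* ((g :* gᵐ) :* gʳ))) :+ v′ :* (x :* (xˢ :* ((g :* gᵐ) :* gˢ))))
             X.refl G (G ^ m) (x^ 1) (const u) (x^ (2 * r)) (G ^ r) (const v) (x^ (2 * s)) (G ^ s) ⟩
      G ^ m X.+ const u X.* (x^ 1 X.* (x^ (2 * r) X.* (G ^ suc m X.* G ^ r)))
            X.+ const v X.* (x^ 1 X.* (x^ (2 * s) X.* (G ^ suc m X.* G ^ s)))
    ≈⟨ X.+-cong (X.+-congˡ (X.*-congˡ (X.*-congˡ (X.*-congˡ (X.sym (^-homo-* G (suc m) r))))))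
                (X.*-congˡ (X.*-congˡ (X.*-congˡ (X.sym (^-homo-* G (suc m) s))))) ⟩
      G ^ m X.+ const u X.* (x^ 1 X.* (x^ (2 * r) X.* G ^ (suc m + r)))
            X.+ const v X.* (x^ 1 X.* (x^ (2 * s) X.* G ^ (suc m + s)))
    ∎
    where
    open import Relation.Binary.Reasoning.Setoid X.setoid
    open import Algebra.Solver.Ring.NaturalCoefficients.Default ℕ⟦u,v⟧⟦x⟧.commutativeSemiring
    open import Algebra.Properties.Semiring.Exp X.semiring using (^-homo-*)

  const-*-coefficient : ∀ c H n → (const c X.* H) n UV.≈ c UV.* H n
  const-*-coefficient c H n = monomial-*ₛ-≤ 0 c H n z≤n

  x^-*-coefficient : ∀ k H n → (x^ k X.* H) (k + n) UV.≈ H n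
  x^-*-coefficient k H n = UV.trans (monomial-*ₛ-≤ k UV.1# H (k + n) (ℕₚ.m≤m+n k n))
                                    (UV.trans (UV.*-identityˡ _) (UV.reflexive (cong H (ℕₚ.m+n∸m≡n k n))))

  weight : ℕ → ℕ → ℕ
  weight a b = a * (2 * r + 1) + b * (2 * s + 1)

  weight-sucʳ : ∀ a b → weight (suc a) b ≡ 1 + (2 * r + weight a b)
  weight-sucʳ a b = lemma a b r s
    where lemma : ∀ a b r s → suc a * (2 * r + 1) + b * (2 * s + 1)
                              ≡ 1 + (2 * r + (a * (2 * r + 1) + b * (2 * s + 1)))
          lemma = solve-∀

  weight-sucˢ : ∀ a b → weight a (suc b) ≡ 1 + (2 * s + weight a b)
  weight-sucˢ a b = lemma a b r s
    where lemma : ∀ a b r s → a * (2 * r + 1) + suc b * (2 * s + 1)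
                              ≡ 1 + (2 * s + (a * (2 * r + 1) + b * (2 * s + 1)))
          lemma = solve-∀

  module Coefficients (G : ℕ⟦u,v⟧⟦x⟧.Series) (G≈ : G X.≈ X.1# X.+ x^ 1 X.* (G X.* B G)) where

    coefficient : ℕ → ℕ → ℕ → ℕ
    coefficient m a b = (G ^ m) (weight a b) a b

    open ClosedForm r s coefficient public

    r-contribution : ∀ m a b → (const u X.* (x^ 1 X.* (x^ (2 * r) X.* G ^ (suc m + r)))) (weight a b) a b
                               ≡ removeR m a b
    r-contribution m zero    b = trans (const-*-coefficient u H (weight 0 b) 0 b) (u-*ₛ-zero (H (weight 0 b)) b)
      where H = x^ 1 X.* (x^ (2 * r) X.* G ^ (suc m + r))
    r-contribution m (suc a) b = begin
        (const u X.* H) (weight (suc a) b) (suc a) b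
      ≡⟨ trans (const-*-coefficient u H (weight (suc a) b) (suc a) b) (u-*ₛ-suc (H (weight (suc a) b)) a b) ⟩
        H (weight (suc a) b) a b
      ≡⟨ cong (λ n → H n a b) (weight-sucʳ a b) ⟩
        H (1 + (2 * r + weight a b)) a b
      ≡⟨ trans (x^-*-coefficient 1 (x^ (2 * r) X.* G ^ (suc m + r)) (2 * r + weight a b) a b)
                 (x^-*-coefficient (2 * r) (G ^ (suc m + r)) (weight a b) a b) ⟩
        coefficient (suc m + r) a b
      ∎
      where
      open ≡.≡-Reasoning
      H = x^ 1 X.* (x^ (2 * r) X.* G ^ (suc m + r))

    s-contribution : ∀ m a b → (const v X.* (x^ 1 X.* (x^ (2 * s) X.* G ^ (suc m + s)))) (weight a b) a b
                               ≡ removeS m a b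
    s-contribution m a zero    = trans (const-*-coefficient v H (weight a 0) a 0) (v-*ₛ-zero (H (weight a 0)) a)
      where H = x^ 1 X.* (x^ (2 * s) X.* G ^ (suc m + s))
    s-contribution m a (suc b) = begin
        (const v X.* H) (weight a (suc b)) a (suc b)
      ≡⟨ trans (const-*-coefficient v H (weight a (suc b)) a (suc b)) (v-*ₛ-suc (H (weight a (suc b))) a b) ⟩
        H (weight a (suc b)) a b
      ≡⟨ cong (λ n → H n a b) (weight-sucˢ a b) ⟩
        H (1 + (2 * s + weight a b)) a b
      ≡⟨ trans (x^-*-coefficient 1 (x^ (2 * s) X.* G ^ (suc m + s)) (2 * s + weight a b) a b)
                 (x^-*-coefficient (2 * s) (G ^ (suc m + s)) (weight a b) a b) ⟩
        coefficient (suc m + s) a b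
      ∎
      where
      open ≡.≡-Reasoning
      H = x^ 1 X.* (x^ (2 * s) X.* G ^ (suc m + s))

    coefficient-suc : ∀ m a b → coefficient (suc m) a b ≡ coefficient m a b + removeR m a b + removeS m a b
    coefficient-suc m a b = trans (^-suc-expansion G G≈ m (weight a b) a b)
      (cong₂ _+_ (cong (coefficient m a b +_) (r-contribution m a b)) (s-contribution m a b))

    coefficient-zero-sucʳ : ∀ a b → coefficient 0 (suc a) b ≡ 0
    coefficient-zero-sucʳ a b = cong (λ n → X.1# n (suc a) b) (weight-sucʳ a b)

    coefficient-zero-sucˢ : ∀ b → coefficient 0 0 (suc b) ≡ 0
    coefficient-zero-sucˢ b = cong (λ n → X.1# n 0 (suc b)) (weight-sucˢ 0 b)

    coefficient-closed-form : ∀ m a b → coefficient (suc m) a b * denominator m a b ≡ suc m * L m a b !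
    coefficient-closed-form m a b =
      closed-form refl coefficient-zero-sucʳ coefficient-zero-sucˢ coefficient-suc a b m

open import Data.Nat using (NonZero)
open import Data.Nat.Combinatorics using (_C_; k![n∸k]!∣n!)
open import Data.Nat.Combinatorics.Specification using (nCk≡n!/k![n-k]!)
open import Data.Nat.DivMod using (m/n*n≡m)
open import Data.Product using (_×_)

nCk*k!*[n∸k]!≡n! : ∀ {n k} → k ≤ n → (n C k) * (k ! * (n ∸ k) !) ≡ n !
nCk*k!*[n∸k]!≡n! {n} {k} k≤n = trans (cong (_* (k ! * (n ∸ k) !)) (nCk≡n!/k![n-k]! k≤n))
                                     (m/n*n≡m {{ℕₚ._!*_!≢0 k (n ∸ k)}} (k![n∸k]!∣n! k≤n))

nCa*[n∸a]Cb*a!*b!*[n∸a∸b]!≡n! : ∀ {n a b} → a + b ≤ n →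
  (n C a) * ((n ∸ a) C b) * (a ! * b ! * (n ∸ a ∸ b) !) ≡ n !
nCa*[n∸a]Cb*a!*b!*[n∸a∸b]!≡n! {n} {a} {b} a+b≤n = begin
    (n C a) * ((n ∸ a) C b) * (a ! * b ! * (n ∸ a ∸ b) !)
  ≡⟨ regroup (n C a) ((n ∸ a) C b) (a !) (b !) ((n ∸ a ∸ b) !) ⟩
    (n C a) * (a ! * (((n ∸ a) C b) * (b ! * (n ∸ a ∸ b) !)))
  ≡⟨ cong (λ k → (n C a) * (a ! * k)) (nCk*k!*[n∸k]!≡n! b≤n∸a) ⟩
    (n C a) * (a ! * (n ∸ a) !)
  ≡⟨ nCk*k!*[n∸k]!≡n! (ℕₚ.≤-trans (ℕₚ.m≤m+n a b) a+b≤n) ⟩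
    n !
  ∎
  where
  open ≡.≡-Reasoning
  b≤n∸a : b ≤ n ∸ a
  b≤n∸a = subst (_≤ n ∸ a) (ℕₚ.m+n∸m≡n a b) (ℕₚ.∸-monoˡ-≤ a a+b≤n)
  regroup : ∀ x y A B Z → x * y * (A * B * Z) ≡ x * (A * (y * (B * Z)))
  regroup = solve-∀

m+n+o∸n∸o≡m : ∀ m n o → m + n + o ∸ n ∸ o ≡ m
m+n+o∸n∸o≡m m n o = begin
  m + n + o ∸ n ∸ o      ≡⟨ ℕₚ.∸-+-assoc (m + n + o) n o ⟩
  m + n + o ∸ (n + o)    ≡⟨ cong (_∸ (n + o)) (ℕₚ.+-assoc m n o) ⟩
  m + (n + o) ∸ (n + o)  ≡⟨ ℕₚ.m+n∸n≡m m (n + o) ⟩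
  m                      ∎
  where open ≡.≡-Reasoning

factorial-form⇒binomial-form : ∀ c m n a b → let ℓ = n + a + b in
  c * (a ! * b ! * suc n !) ≡ m * ℓ ! → c * suc n ≡ m * (ℓ C a) * ((ℓ ∸ a) C b)
factorial-form⇒binomial-form c m n a b factorial-form =
  ℕₚ.*-cancelʳ-≡ (c * suc n) (m * (ℓ C a) * ((ℓ ∸ a) C b)) (a ! * b ! * n !) {{nonZero}} (begin
      c * suc n * (a ! * b ! * n !)
    ≡⟨ move-suc c (suc n) (a !) (b !) (n !) ⟩
      c * (a ! * b ! * suc n !)
    ≡⟨ factorial-form ⟩
      m * ℓ !
    ≡⟨ cong (m *_) (nCa*[n∸a]Cb*a!*b!*[n∸a∸b]!≡n! {ℓ} {a} {b} a+b≤ℓ) ⟨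
      m * ((ℓ C a) * ((ℓ ∸ a) C b) * (a ! * b ! * (ℓ ∸ a ∸ b) !))
    ≡⟨ cong (λ k → m * ((ℓ C a) * ((ℓ ∸ a) C b) * (a ! * b ! * k !))) (m+n+o∸n∸o≡m n a b) ⟩
      m * ((ℓ C a) * ((ℓ ∸ a) C b) * (a ! * b ! * n !))
    ≡⟨ regroup m (ℓ C a) ((ℓ ∸ a) C b) (a ! * b ! * n !) ⟩
      m * (ℓ C a) * ((ℓ ∸ a) C b) * (a ! * b ! * n !)
    ∎)
  where
  open ≡.≡-Reasoning
  ℓ = n + a + b
  nonZero : NonZero (a ! * b ! * n !)
  nonZero = ℕₚ.m*n≢0 (a ! * b !) (n !) {{ℕₚ._!*_!≢0 a b}} {{ℕₚ._!≢0 n}}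
  move-suc : ∀ c k A B Y → c * k * (A * B * Y) ≡ c * (A * B * (k * Y))
  move-suc = solve-∀
  a+b≤ℓ : a + b ≤ ℓ
  a+b≤ℓ = subst (a + b ≤_) (sym (ℕₚ.+-assoc n a b)) (ℕₚ.m≤n+m (a + b) n)
  regroup : ∀ m x y Z → m * (x * y * Z) ≡ m * x * y * Z
  regroup = solve-∀

theorem6 : (g : Series) → IsG g →
    (m : ℕ) → .{{_ : NonZero m}} → (r s : ℕ) → r ≢ s → (mr ms : ℕ) →
    let k = mr * (r + 1) + ms * (s + 1)
        c = coeff (mono2 r mr s ms) ((g ^S m) (mr * (2 * r + 1) + ms * (2 * s + 1)))
    in (c * (m + k ∸ mr ∸ ms) ≡ m * ((m + k ∸ 1) C mr) * ((m + k ∸ 1 ∸ mr) C ms))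
       × (c * ((mr !) * (ms !) * ((m + k ∸ mr ∸ ms) !)) ≡ m * ((m + k ∸ 1) !))
theorem6 g isG (suc m) r s r≢s mr ms =
  subst₂ (λ n ℓ → c * n ≡ suc m * (ℓ C mr) * ((ℓ ∸ mr) C ms)) (sym m+k∸mr∸ms) (sym m+k∸1)
    (factorial-form⇒binomial-form c (suc m) (N m mr ms) mr ms closed-form′)
  , subst₂ (λ n ℓ → c * (mr ! * ms ! * n !) ≡ suc m * ℓ !) (sym m+k∸mr∸ms) (sym m+k∸1) closed-form′
  where
  open EvaluatedSeries r≢s
  open Coefficients (evalSeries g) (evalSeries-IsG g isG)
  c = coeff (mono2 r mr s ms) ((g ^S suc m) (weight mr ms))
  closed-form′ : c * denominator m mr ms ≡ suc m * L m mr ms !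
  closed-form′ = trans (cong (_* denominator m mr ms) (coeff-mono-^S g (suc m) (weight mr ms) mr ms))
                       (coefficient-closed-form m mr ms)
  m+k≡1+L : suc m + (mr * (r + 1) + ms * (s + 1)) ≡ suc (L m mr ms)
  m+k≡1+L = lemma m mr ms r s
    where lemma : ∀ m a b r s → suc m + (a * (r + 1) + b * (s + 1)) ≡ suc (m + a * r + b * s + a + b)
          lemma = solve-∀
  m+k∸1 : suc m + (mr * (r + 1) + ms * (s + 1)) ∸ 1 ≡ L m mr ms
  m+k∸1 = cong (_∸ 1) m+k≡1+L
  m+k∸mr∸ms : suc m + (mr * (r + 1) + ms * (s + 1)) ∸ mr ∸ ms ≡ suc (N m mr ms)
  m+k∸mr∸ms = trans (cong (λ n → n ∸ mr ∸ ms) m+k≡1+L) (m+n+o∸n∸o≡m (suc (N m mr ms)) mr ms)
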